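{- Let $m,k\in\mathbb{N}$, let $\ell\in\mathbb{N}$ (so $\ell\ge1$), and let $\mathbf{A}\in\mathbb{Z}^{m\times k}$ satisfy the columns condition at level $\ell$. Then there exist $c\in\mathbb{N}$, a set $J\subset\{1,\ldots,k\}$, integers $\sigma_j\in\mathbb{Z}$ for $j\in J$, and a matrix $\mathbf{B}\in\mathbb{Z}^{m\times k}$ such that: (1) $\mathbf{B}$ satisfies the columns condition at level $\ell-1$; and (2) whenever $\mathbf{y}=(y_1,\ldots,y_k)\in\mathbb{Z}^k$ satisfies $\mathbf{B}\cdot\mathbf{y}=\mathbf{0}$, then for every $a\in\mathbb{Z}$ the vector $\mathbf{x}=(x_1,\ldots,x_k)$ with $x_j=a+\sigma_j y_j$ for $j\in J$ and $x_j=c\,y_j$ for $j\notin J$ satisfies $\mathbf{A}\cdot\mathbf{x}=\mathbf{0}$.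
   Context: Let $\mathbf{a}_1,\ldots,\mathbf{a}_k$ be the columns of a matrix $\mathbf{A}\in\mathbb{Z}^{m\times k}$. For $\ell\in\mathbb{N}\cup\{0\}$, $\mathbf{A}$ satisfies the columns condition at level $\ell$ if there is a partition $\{1,\ldots,k\}=J_0\cup J_1\cup\cdots\cup J_\ell$ into disjoint sets such that $\sum_{j\in J_0}\mathbf{a}_j=\mathbf{0}$ and, for every $s\in\{1,\ldots,\ell\}$, there are rationals $\lambda_{js}$ ($j\in J_0\cup\cdots\cup J_{s-1}$) with $\sum_{j\in J_s}\mathbf{a}_j=\sum_{j\in J_0\cup\cdots\cup J_{s-1}}\lambda_{js}\mathbf{a}_j$. -}

module Defs where

open import Data.Nat as ℕ using (ℕ; zero; suc)
open import Data.Fin as Fin using (Fin; toℕ)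
open import Data.Integer as ℤ using (ℤ)
open import Data.Rational as ℚ using (ℚ)
open import Data.Bool using (Bool; true; false; if_then_else_)
open import Data.Product using (Σ; ∃; _×_; _,_)
open import Relation.Binary.PropositionalEquality using (_≡_)
open import Relation.Nullary.Decidable using (⌊_⌋)
open import Data.Vec.Functional using (Vector)

-- An integer matrix with m rows and k columns; column j is  λ i → A i j.
Matrix : ℕ → ℕ → Set
Matrix m k = Fin m → Fin k → ℤ

sumℤ : ∀ {n} → (Fin n → ℤ) → ℤ
sumℤ {zero}  f = ℤ.0ℤ
sumℤ {suc n} f = f Fin.zero ℤ.+ sumℤ (λ j → f (Fin.suc j))

sumℚ : ∀ {n} → (Fin n → ℚ) → ℚ
sumℚ {zero}  f = ℚ.0ℚ
sumℚ {suc n} f = f Fin.zero ℚ.+ sumℚ (λ j → f (Fin.suc j))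

-- The partition {1..k} = J₀ ∪ … ∪ J_ℓ is
-- encoded by the level map  lvl : Fin k → Fin (suc ℓ)  (j ∈ J_s iff lvl j = s).
-- (J_s may be empty, as in the paper's definition.)
-- Level 0:  Σ_{j ∈ J₀} a_j = 0.
-- Level s ≥ 1: there are rationals λ_j (only those with lvl j < s used) with
--   Σ_{j ∈ J_s} a_j = Σ_{j ∈ J₀ ∪ … ∪ J_{s-1}} λ_j a_j   (as vectors in ℚ^m).
ColumnsCondition : ∀ {m k} → ℕ → Matrix m k → Set
ColumnsCondition {m} {k} ℓ A =
  Σ (Fin k → Fin (suc ℓ)) λ lvl →
    ((i : Fin m) →
       sumℤ (λ j → if ⌊ toℕ (lvl j) ℕ.≟ 0 ⌋ then A i j else ℤ.0ℤ) ≡ ℤ.0ℤ)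
    × ((s : Fin (suc ℓ)) → 1 ℕ.≤ toℕ s →
        Σ (Fin k → ℚ) λ coeff →
          (i : Fin m) →
            ℚ._/_ (sumℤ (λ j → if ⌊ toℕ (lvl j) ℕ.≟ toℕ s ⌋ then A i j else ℤ.0ℤ)) 1
            ≡ sumℚ (λ j → if ⌊ toℕ (lvl j) ℕ.<? toℕ s ⌋
                            then coeff j ℚ.* (ℚ._/_ (A i j) 1)
                            else ℚ.0ℚ))

_·_ : ∀ {m k} → Matrix m k → (Fin k → ℤ) → (Fin m → ℤ)
(A · x) i = sumℤ (λ j → A i j ℤ.* x j)

-- Let λ express the level-1 column sum through the level-0 columns, and clear its
-- denominators: c Σ_{J₁} a_j = Σ_{J₀} μ_j a_j with c ≥ 1 and μ_j ∈ ℤ.  Pick t > every μ_j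
-- and put σ_j = t − μ_j ≠ 0.  B scales column j by σ_j on J₀ and by c elsewhere.  With
-- J₀ ∪ J₁ merged into the new bottom level, its column sum is
-- t Σ_{J₀} a_j − Σ_{J₀} μ_j a_j + c Σ_{J₁} a_j = 0, while each higher level keeps a rational
-- relation because all scalings are nonzero.  Finally A x = a Σ_{J₀} a_j + B y = 0.

{-# OPTIONS --safe #-}
module Submission where

open import Defs
open import Data.Nat using (ℕ; suc; _≤_)
open import Data.Fin using (Fin)
open import Data.Integer using (ℤ; +_; _+_; _*_; 0ℤ)
open import Data.Bool using (Bool; if_then_else_)
open import Data.Product using (Σ; _×_)
open import Relation.Binary.PropositionalEquality using (_≡_)

open import Data.Bool using (true; false)
open import Data.Fin as Fin using (toℕ; pinch)
open import Data.Integer.Tactic.RingSolver using (solve-∀)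
open import Data.Nat as ℕ using (zero)
import Data.Nat.Properties as ℕ
import Data.Integer as ℤ
import Data.Integer.Properties as ℤ
open import Algebra.Properties.CommutativeSemigroup ℤ.+-commutativeSemigroup using (interchange)
open import Algebra.Properties.AbelianGroup ℤ.+-0-abelianGroup using (∙-cancelʳ)
open import Data.Product using (_,_; ∃-syntax)
open import Data.Rational as ℚ using (ℚ; 0ℚ)
import Data.Rational.Properties as ℚ
open import Data.Rational.Unnormalised as ℚᵘ using (mkℚᵘ; *≡*)
import Data.Rational.Unnormalised.Properties as ℚᵘ
open import Function using (_∘_)
open import Relation.Binary.PropositionalEquality
  using (_≢_; refl; sym; trans; cong; cong₂; module ≡-Reasoning)
open import Relation.Nullary.Decidable using (⌊_⌋; isYes≗does)

ι : ℤ → ℚ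
ι a = a ℚ./ 1

toℚᵘ-ι : ∀ a → ℚ.toℚᵘ (ι a) ℚᵘ.≃ mkℚᵘ a 0
toℚᵘ-ι a = ℚ.toℚᵘ-fromℚᵘ (mkℚᵘ a 0)

ι-homo-+ : ∀ a b → ι (a + b) ≡ ι a ℚ.+ ι b
ι-homo-+ a b = ℚ.toℚᵘ-injective (begin
  ℚ.toℚᵘ (ι (a + b))                    ≈⟨ toℚᵘ-ι (a + b) ⟩
  mkℚᵘ (a + b) 0                         ≈⟨ *≡* (cross a b) ⟩
  mkℚᵘ a 0 ℚᵘ.+ mkℚᵘ b 0                 ≈⟨ ℚᵘ.+-cong (toℚᵘ-ι a) (toℚᵘ-ι b) ⟨
  ℚ.toℚᵘ (ι a) ℚᵘ.+ ℚ.toℚᵘ (ι b)       ≈⟨ ℚ.toℚᵘ-homo-+ (ι a) (ι b) ⟨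
  ℚ.toℚᵘ (ι a ℚ.+ ι b)                  ∎)
  where
  open ℚᵘ.≃-Reasoning
  cross : ∀ a b → (a + b) * + 1 ≡ (a * + 1 + b * + 1) * + 1
  cross = solve-∀

ι-homo-* : ∀ a b → ι (a * b) ≡ ι a ℚ.* ι b
ι-homo-* a b = ℚ.toℚᵘ-injective (begin
  ℚ.toℚᵘ (ι (a * b))                    ≈⟨ toℚᵘ-ι (a * b) ⟩
  mkℚᵘ (a * b) 0                         ≈⟨ *≡* refl ⟩
  mkℚᵘ a 0 ℚᵘ.* mkℚᵘ b 0                 ≈⟨ ℚᵘ.*-cong (toℚᵘ-ι a) (toℚᵘ-ι b) ⟨
  ℚ.toℚᵘ (ι a) ℚᵘ.* ℚ.toℚᵘ (ι b)       ≈⟨ ℚ.toℚᵘ-homo-* (ι a) (ι b) ⟨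
  ℚ.toℚᵘ (ι a ℚ.* ι b)                  ∎)
  where open ℚᵘ.≃-Reasoning

ι-injective : ∀ {a b} → ι a ≡ ι b → a ≡ b
ι-injective {a} {b} ιa≡ιb with ℚ.fromℚᵘ-injective {mkℚᵘ a 0} {mkℚᵘ b 0} ιa≡ιb
... | *≡* a*1≡b*1 = begin
  a          ≡⟨ ℤ.*-identityʳ a ⟨
  a * + 1    ≡⟨ a*1≡b*1 ⟩
  b * + 1    ≡⟨ ℤ.*-identityʳ b ⟩
  b          ∎
  where open ≡-Reasoning

ι-nonZero : ∀ {a} → a ≢ 0ℤ → ℚ.NonZero (ι a)
ι-nonZero a≢0 = ℚ.≢-nonZero (a≢0 ∘ ι-injective {b = 0ℤ})

ι↧*p≡ι↥ : ∀ p → ι (ℚ.↧ p) ℚ.* p ≡ ι (ℚ.↥ p)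
ι↧*p≡ι↥ p@(ℚ.mkℚ n d-1 _) = ℚ.toℚᵘ-injective (begin
  ℚ.toℚᵘ (ι (ℚ.↧ p) ℚ.* p)          ≈⟨ ℚ.toℚᵘ-homo-* (ι (ℚ.↧ p)) p ⟩
  ℚ.toℚᵘ (ι (ℚ.↧ p)) ℚᵘ.* mkℚᵘ n d-1 ≈⟨ ℚᵘ.*-congʳ (toℚᵘ-ι (ℚ.↧ p)) ⟩
  mkℚᵘ (ℚ.↧ p) 0 ℚᵘ.* mkℚᵘ n d-1     ≈⟨ *≡* (cross n (ℚ.↧ₙ p)) ⟩
  mkℚᵘ n 0                           ≈⟨ toℚᵘ-ι n ⟨
  ℚ.toℚᵘ (ι n)                      ∎)
  where
  open ℚᵘ.≃-Reasoning
  cross : ∀ n d → (+ d * n) * + 1 ≡ n * + (1 ℕ.* d)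
  cross n d = trans (ℤ.*-identityʳ (+ d * n))
    (trans (ℤ.*-comm (+ d) n) (cong (λ e → n * + e) (sym (ℕ.*-identityˡ d))))

p/x*[x*q]≡p*q : ∀ p x q .{{_ : ℚ.NonZero x}} → (p ℚ.* ℚ.1/ x) ℚ.* (x ℚ.* q) ≡ p ℚ.* q
p/x*[x*q]≡p*q p x q = begin
  (p ℚ.* ℚ.1/ x) ℚ.* (x ℚ.* q)  ≡⟨ ℚ.*-assoc p (ℚ.1/ x) (x ℚ.* q) ⟩
  p ℚ.* (ℚ.1/ x ℚ.* (x ℚ.* q))  ≡⟨ cong (p ℚ.*_) (ℚ.*-assoc (ℚ.1/ x) x q) ⟨
  p ℚ.* ((ℚ.1/ x ℚ.* x) ℚ.* q)  ≡⟨ cong (λ y → p ℚ.* (y ℚ.* q)) (ℚ.*-inverseˡ x) ⟩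
  p ℚ.* (ℚ.1ℚ ℚ.* q)            ≡⟨ cong (p ℚ.*_) (ℚ.*-identityˡ q) ⟩
  p ℚ.* q                       ∎
  where open ≡-Reasoning

commonDenominator : ∀ {n} (q : Fin n → ℚ) →
                    ∃[ d ] Σ (Fin n → ℤ) λ μ → ∀ j → ι (μ j) ≡ ι (+ suc d) ℚ.* q j
commonDenominator {zero}  q = 0 , (λ ()) , (λ ())
commonDenominator {suc n} q with commonDenominator (q ∘ Fin.suc)
... | d , μ , μ≡dq = ℕ.pred D , μ′ , μ′≡Dq
  where
  q₀ : ℚ
  q₀ = q Fin.zero
  -- D is a product of two successors, hence definitionally suc (ℕ.pred D).
  D : ℕ
  D = ℚ.↧ₙ q₀ ℕ.* suc d
  e s : ℚ
  e = ι (ℚ.↧ q₀)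
  s = ι (+ suc d)
  ιD≡e*s : ι (+ D) ≡ e ℚ.* s
  ιD≡e*s = trans (cong ι (ℤ.pos-* (ℚ.↧ₙ q₀) (suc d))) (ι-homo-* (ℚ.↧ q₀) (+ suc d))
  μ′ : Fin (suc n) → ℤ
  μ′ Fin.zero    = ℚ.↥ q₀ * + suc d
  μ′ (Fin.suc j) = ℚ.↧ q₀ * μ j
  μ′≡Dq : ∀ j → ι (μ′ j) ≡ ι (+ D) ℚ.* q j
  μ′≡Dq Fin.zero = begin
    ι (ℚ.↥ q₀ * + suc d)  ≡⟨ ι-homo-* (ℚ.↥ q₀) (+ suc d) ⟩
    ι (ℚ.↥ q₀) ℚ.* s      ≡⟨ cong (ℚ._* s) (ι↧*p≡ι↥ q₀) ⟨
    (e ℚ.* q₀) ℚ.* s      ≡⟨ ℚ.*-assoc e q₀ s ⟩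
    e ℚ.* (q₀ ℚ.* s)      ≡⟨ cong (e ℚ.*_) (ℚ.*-comm q₀ s) ⟩
    e ℚ.* (s ℚ.* q₀)      ≡⟨ ℚ.*-assoc e s q₀ ⟨
    (e ℚ.* s) ℚ.* q₀      ≡⟨ cong (ℚ._* q₀) ιD≡e*s ⟨
    ι (+ D) ℚ.* q₀        ∎
    where open ≡-Reasoning
  μ′≡Dq (Fin.suc j) = begin
    ι (ℚ.↧ q₀ * μ j)             ≡⟨ ι-homo-* (ℚ.↧ q₀) (μ j) ⟩
    e ℚ.* ι (μ j)                ≡⟨ cong (e ℚ.*_) (μ≡dq j) ⟩
    e ℚ.* (s ℚ.* q (Fin.suc j))  ≡⟨ ℚ.*-assoc e s (q (Fin.suc j)) ⟨
    (e ℚ.* s) ℚ.* q (Fin.suc j)  ≡⟨ cong (ℚ._* q (Fin.suc j)) ιD≡e*s ⟨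
    ι (+ D) ℚ.* q (Fin.suc j)    ∎
    where open ≡-Reasoning

upperBound : ∀ {n} (μ : Fin n → ℤ) → ∃[ t ] ∀ j → μ j ℤ.< t
upperBound {zero}  μ = 0ℤ , λ ()
upperBound {suc n} μ with upperBound (μ ∘ Fin.suc)
... | t , μ<t = ℤ.suc (μ Fin.zero) ℤ.⊔ t , λ where
  Fin.zero    → ℤ.suc[i]≤j⇒i<j (ℤ.i≤i⊔j (ℤ.suc (μ Fin.zero)) t)
  (Fin.suc j) → ℤ.<-≤-trans (μ<t j) (ℤ.i≤j⊔i (ℤ.suc (μ Fin.zero)) t)

sumℤ-cong : ∀ {n} {f g : Fin n → ℤ} → (∀ j → f j ≡ g j) → sumℤ f ≡ sumℤ g
sumℤ-cong {zero}  f≗g = refl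
sumℤ-cong {suc n} f≗g = cong₂ _+_ (f≗g Fin.zero) (sumℤ-cong (f≗g ∘ Fin.suc))

sumℤ-distrib-+ : ∀ {n} (f g : Fin n → ℤ) → sumℤ (λ j → f j + g j) ≡ sumℤ f + sumℤ g
sumℤ-distrib-+ {zero}  f g = refl
sumℤ-distrib-+ {suc n} f g = trans
  (cong (_+_ (f Fin.zero + g Fin.zero)) (sumℤ-distrib-+ (f ∘ Fin.suc) (g ∘ Fin.suc)))
  (interchange (f Fin.zero) (g Fin.zero) (sumℤ (f ∘ Fin.suc)) (sumℤ (g ∘ Fin.suc)))

*-distribˡ-sumℤ : ∀ {n} c (f : Fin n → ℤ) → c * sumℤ f ≡ sumℤ (λ j → c * f j)
*-distribˡ-sumℤ {zero}  c f = ℤ.*-zeroʳ c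
*-distribˡ-sumℤ {suc n} c f = trans
  (ℤ.*-distribˡ-+ c (f Fin.zero) (sumℤ (f ∘ Fin.suc)))
  (cong (_+_ (c * f Fin.zero)) (*-distribˡ-sumℤ c (f ∘ Fin.suc)))

sumℚ-cong : ∀ {n} {f g : Fin n → ℚ} → (∀ j → f j ≡ g j) → sumℚ f ≡ sumℚ g
sumℚ-cong {zero}  f≗g = refl
sumℚ-cong {suc n} f≗g = cong₂ ℚ._+_ (f≗g Fin.zero) (sumℚ-cong (f≗g ∘ Fin.suc))

*-distribˡ-sumℚ : ∀ {n} c (f : Fin n → ℚ) → c ℚ.* sumℚ f ≡ sumℚ (λ j → c ℚ.* f j)
*-distribˡ-sumℚ {zero}  c f = ℚ.*-zeroʳ c
*-distribˡ-sumℚ {suc n} c f = trans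
  (ℚ.*-distribˡ-+ c (f Fin.zero) (sumℚ (f ∘ Fin.suc)))
  (cong ((c ℚ.* f Fin.zero) ℚ.+_) (*-distribˡ-sumℚ c (f ∘ Fin.suc)))

ι-sumℤ : ∀ {n} (f : Fin n → ℤ) → ι (sumℤ f) ≡ sumℚ (ι ∘ f)
ι-sumℤ {zero}  f = refl
ι-sumℤ {suc n} f = trans (ι-homo-+ (f Fin.zero) (sumℤ (f ∘ Fin.suc)))
                         (cong (ι (f Fin.zero) ℚ.+_) (ι-sumℤ (f ∘ Fin.suc)))

sumOver : ∀ {n} → (Fin n → Bool) → (Fin n → ℤ) → ℤ
sumOver S f = sumℤ (λ j → if S j then f j else 0ℤ)

sumOverℚ : ∀ {n} → (Fin n → Bool) → (Fin n → ℚ) → ℚ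
sumOverℚ S f = sumℚ (λ j → if S j then f j else 0ℚ)

sumOver-cong : ∀ {n} (S : Fin n → Bool) {f g : Fin n → ℤ} →
               (∀ j → S j ≡ true → f j ≡ g j) → sumOver S f ≡ sumOver S g
sumOver-cong S {f} {g} f≗g = sumℤ-cong pointwise
  where
  pointwise : ∀ j → (if S j then f j else 0ℤ) ≡ (if S j then g j else 0ℤ)
  pointwise j with S j in Sj
  ... | true  = f≗g j Sj
  ... | false = refl

sumOver-congˢ : ∀ {n} {S S′ : Fin n → Bool} (f : Fin n → ℤ) →
                (∀ j → S j ≡ S′ j) → sumOver S f ≡ sumOver S′ f
sumOver-congˢ f S≗S′ = sumℤ-cong (λ j → cong (if_then f j else 0ℤ) (S≗S′ j))

sumOverℚ-cong : ∀ {n} (S : Fin n → Bool) {f g : Fin n → ℚ} →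
                (∀ j → f j ≡ g j) → sumOverℚ S f ≡ sumOverℚ S g
sumOverℚ-cong S f≗g = sumℚ-cong (λ j → cong (if S j then_else 0ℚ) (f≗g j))

sumOverℚ-congˢ : ∀ {n} {S S′ : Fin n → Bool} (f : Fin n → ℚ) →
                 (∀ j → S j ≡ S′ j) → sumOverℚ S f ≡ sumOverℚ S′ f
sumOverℚ-congˢ f S≗S′ = sumℚ-cong (λ j → cong (if_then f j else 0ℚ) (S≗S′ j))

*-distribˡ-sumOver : ∀ {n} c (S : Fin n → Bool) (f : Fin n → ℤ) →
                     c * sumOver S f ≡ sumOver S (λ j → c * f j)
*-distribˡ-sumOver c S f =
  trans (*-distribˡ-sumℤ c (λ j → if S j then f j else 0ℤ)) (sumℤ-cong pointwise)
  where
  pointwise : ∀ j → c * (if S j then f j else 0ℤ) ≡ (if S j then c * f j else 0ℤ)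
  pointwise j with S j
  ... | true  = refl
  ... | false = ℤ.*-zeroʳ c

*-distribˡ-sumOverℚ : ∀ {n} c (S : Fin n → Bool) (f : Fin n → ℚ) →
                      c ℚ.* sumOverℚ S f ≡ sumOverℚ S (λ j → c ℚ.* f j)
*-distribˡ-sumOverℚ c S f =
  trans (*-distribˡ-sumℚ c (λ j → if S j then f j else 0ℚ)) (sumℚ-cong pointwise)
  where
  pointwise : ∀ j → c ℚ.* (if S j then f j else 0ℚ) ≡ (if S j then c ℚ.* f j else 0ℚ)
  pointwise j with S j
  ... | true  = refl
  ... | false = ℚ.*-zeroʳ c

ι-sumOver : ∀ {n} (S : Fin n → Bool) (f : Fin n → ℤ) → ι (sumOver S f) ≡ sumOverℚ S (ι ∘ f)
ι-sumOver S f = trans (ι-sumℤ (λ j → if S j then f j else 0ℤ)) (sumℚ-cong pointwise)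
  where
  pointwise : ∀ j → ι (if S j then f j else 0ℤ) ≡ (if S j then ι (f j) else 0ℚ)
  pointwise j with S j
  ... | true  = refl
  ... | false = refl

SpanRelation : ∀ {m k} → Matrix m k → (S R : Fin k → Bool) → Set
SpanRelation {m} {k} A S R =
  Σ (Fin k → ℚ) λ coeff → ∀ i → ι (sumOver S (A i)) ≡ sumOverℚ R (λ j → coeff j ℚ.* ι (A i j))

SpanRelation-congˢ : ∀ {m k} {A : Matrix m k} {S S′ R R′ : Fin k → Bool} →
                     (∀ j → S j ≡ S′ j) → (∀ j → R j ≡ R′ j) →
                     SpanRelation A S R → SpanRelation A S′ R′
SpanRelation-congˢ {A = A} {S} {S′} {R} {R′} S≗S′ R≗R′ (coeff , rel) = coeff , rel′
  where
  open ≡-Reasoning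
  rel′ : ∀ i → ι (sumOver S′ (A i)) ≡ sumOverℚ R′ (λ j → coeff j ℚ.* ι (A i j))
  rel′ i = begin
    ι (sumOver S′ (A i))                       ≡⟨ cong ι (sumOver-congˢ (A i) S≗S′) ⟨
    ι (sumOver S (A i))                        ≡⟨ rel i ⟩
    sumOverℚ R (λ j → coeff j ℚ.* ι (A i j))   ≡⟨ sumOverℚ-congˢ _ R≗R′ ⟩
    sumOverℚ R′ (λ j → coeff j ℚ.* ι (A i j))  ∎

clearDenominators : ∀ {m k} {A : Matrix m k} {S R : Fin k → Bool} → SpanRelation A S R →
                    ∃[ d ] Σ (Fin k → ℤ) λ μ →
                      ∀ i → sumOver R (λ j → μ j * A i j) ≡ + suc d * sumOver S (A i)
clearDenominators {A = A} {S} {R} (coeff , rel) with commonDenominator coeff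
... | d , μ , μ≡dcoeff = d , μ , λ i → ι-injective (begin
  ι (sumOver R (λ j → μ j * A i j))                     ≡⟨ ι-sumOver R (λ j → μ j * A i j) ⟩
  sumOverℚ R (λ j → ι (μ j * A i j))                    ≡⟨ sumOverℚ-cong R (pointwise i) ⟩
  sumOverℚ R (λ j → ι c ℚ.* (coeff j ℚ.* ι (A i j)))    ≡⟨ *-distribˡ-sumOverℚ (ι c) R _ ⟨
  ι c ℚ.* sumOverℚ R (λ j → coeff j ℚ.* ι (A i j))      ≡⟨ cong (ι c ℚ.*_) (rel i) ⟨
  ι c ℚ.* ι (sumOver S (A i))                           ≡⟨ ι-homo-* c (sumOver S (A i)) ⟨
  ι (c * sumOver S (A i))                               ∎)
  where
  open ≡-Reasoning
  c : ℤ
  c = + suc d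
  pointwise : ∀ i j → ι (μ j * A i j) ≡ ι c ℚ.* (coeff j ℚ.* ι (A i j))
  pointwise i j = begin
    ι (μ j * A i j)                   ≡⟨ ι-homo-* (μ j) (A i j) ⟩
    ι (μ j) ℚ.* ι (A i j)             ≡⟨ cong (ℚ._* ι (A i j)) (μ≡dcoeff j) ⟩
    (ι c ℚ.* coeff j) ℚ.* ι (A i j)   ≡⟨ ℚ.*-assoc (ι c) (coeff j) (ι (A i j)) ⟩
    ι c ℚ.* (coeff j ℚ.* ι (A i j))   ∎

scaleColumns : ∀ {m k} → (Fin k → ℤ) → Matrix m k → Matrix m k
scaleColumns τ A i j = τ j * A i j

SpanRelation-scaleColumns : ∀ {m k} {A : Matrix m k} {S R : Fin k → Bool}
                            (τ : Fin k → ℤ) (c : ℤ) →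
                            (∀ j → τ j ≢ 0ℤ) → (∀ j → S j ≡ true → τ j ≡ c) →
                            SpanRelation A S R → SpanRelation (scaleColumns τ A) S R
SpanRelation-scaleColumns {k = k} {A} {S} {R} τ c τ≢0 τ≡c (coeff , rel) = coeff′ , rel′
  where
  open ≡-Reasoning
  coeff′ : Fin k → ℚ
  coeff′ j = (ι c ℚ.* coeff j) ℚ.* (ℚ.1/ ι (τ j)) {{ι-nonZero (τ≢0 j)}}
  cancel : ∀ i j → coeff′ j ℚ.* ι (τ j * A i j) ≡ ι c ℚ.* (coeff j ℚ.* ι (A i j))
  cancel i j = begin
    coeff′ j ℚ.* ι (τ j * A i j)
      ≡⟨ cong (coeff′ j ℚ.*_) (ι-homo-* (τ j) (A i j)) ⟩
    coeff′ j ℚ.* (ι (τ j) ℚ.* ι (A i j))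
      ≡⟨ p/x*[x*q]≡p*q (ι c ℚ.* coeff j) (ι (τ j)) (ι (A i j)) {{ι-nonZero (τ≢0 j)}} ⟩
    (ι c ℚ.* coeff j) ℚ.* ι (A i j)
      ≡⟨ ℚ.*-assoc (ι c) (coeff j) (ι (A i j)) ⟩
    ι c ℚ.* (coeff j ℚ.* ι (A i j))
      ∎
  rel′ : ∀ i → ι (sumOver S (scaleColumns τ A i))
                 ≡ sumOverℚ R (λ j → coeff′ j ℚ.* ι (τ j * A i j))
  rel′ i = begin
    ι (sumOver S (λ j → τ j * A i j))
      ≡⟨ cong ι (sumOver-cong S (λ j Sj → cong (_* A i j) (τ≡c j Sj))) ⟩
    ι (sumOver S (λ j → c * A i j))
      ≡⟨ cong ι (*-distribˡ-sumOver c S (A i)) ⟨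
    ι (c * sumOver S (A i))
      ≡⟨ ι-homo-* c (sumOver S (A i)) ⟩
    ι c ℚ.* ι (sumOver S (A i))
      ≡⟨ cong (ι c ℚ.*_) (rel i) ⟩
    ι c ℚ.* sumOverℚ R (λ j → coeff j ℚ.* ι (A i j))
      ≡⟨ *-distribˡ-sumOverℚ (ι c) R _ ⟩
    sumOverℚ R (λ j → ι c ℚ.* (coeff j ℚ.* ι (A i j)))
      ≡⟨ sumOverℚ-cong R (λ j → cancel i j) ⟨
    sumOverℚ R (λ j → coeff′ j ℚ.* ι (τ j * A i j))
      ∎

·-distrib-+ : ∀ {m k} (A : Matrix m k) (x y : Fin k → ℤ) i →
              (A · (λ j → x j + y j)) i ≡ (A · x) i + (A · y) i
·-distrib-+ A x y i = trans (sumℤ-cong (λ j → ℤ.*-distribˡ-+ (A i j) (x j) (y j)))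
                            (sumℤ-distrib-+ (λ j → A i j * x j) (λ j → A i j * y j))

·-indicator : ∀ {m k} (A : Matrix m k) (S : Fin k → Bool) a i →
              (A · (λ j → if S j then a else 0ℤ)) i ≡ a * sumOver S (A i)
·-indicator A S a i = trans (sumℤ-cong pointwise) (sym (*-distribˡ-sumOver a S (A i)))
  where
  pointwise : ∀ j → A i j * (if S j then a else 0ℤ) ≡ (if S j then a * A i j else 0ℤ)
  pointwise j with S j
  ... | true  = ℤ.*-comm (A i j) a
  ... | false = ℤ.*-zeroʳ (A i j)

·-scaleColumns : ∀ {m k} (A : Matrix m k) (τ y : Fin k → ℤ) i →
                 (A · (λ j → τ j * y j)) i ≡ (scaleColumns τ A · y) i
·-scaleColumns A τ y i = sumℤ-cong (λ j → trans (sym (ℤ.*-assoc (A i j) (τ j) (y j)))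
                                                (cong (_* y j) (ℤ.*-comm (A i j) (τ j))))

kernel-lift : ∀ {m k} (A : Matrix m k) (S : Fin k → Bool) (τ y : Fin k → ℤ) →
              (∀ i → sumOver S (A i) ≡ 0ℤ) → (∀ i → (scaleColumns τ A · y) i ≡ 0ℤ) →
              ∀ a i → (A · (λ j → (if S j then a else 0ℤ) + τ j * y j)) i ≡ 0ℤ
kernel-lift A S τ y ΣS≡0 By≡0 a i = begin
  (A · (λ j → (if S j then a else 0ℤ) + τ j * y j)) i
    ≡⟨ ·-distrib-+ A (λ j → if S j then a else 0ℤ) (λ j → τ j * y j) i ⟩
  (A · (λ j → if S j then a else 0ℤ)) i + (A · (λ j → τ j * y j)) i
    ≡⟨ cong₂ _+_ (·-indicator A S a i) (·-scaleColumns A τ y i) ⟩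
  a * sumOver S (A i) + (scaleColumns τ A · y) i
    ≡⟨ cong₂ _+_ (cong (a *_) (ΣS≡0 i)) (By≡0 i) ⟩
  a * 0ℤ + 0ℤ
    ≡⟨ trans (ℤ.+-identityʳ (a * 0ℤ)) (ℤ.*-zeroʳ a) ⟩
  0ℤ ∎
  where open ≡-Reasoning

-- With these, the clauses of ColumnsCondition are definitionally
-- sumOver (atLevel lvl 0) (A i) ≡ 0ℤ  and  SpanRelation A (atLevel lvl s) (belowLevel lvl s).
atLevel : ∀ {k n} → (Fin k → Fin n) → ℕ → Fin k → Bool
atLevel lvl s j = ⌊ toℕ (lvl j) ℕ.≟ s ⌋

belowLevel : ∀ {k n} → (Fin k → Fin n) → ℕ → Fin k → Bool
belowLevel lvl s j = ⌊ toℕ (lvl j) ℕ.<? s ⌋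

-- Only ⌊_⌋ is stuck here: the builtin tests ≡ᵇ and <ᵇ underlying _≟_ and _<?_ compute on suc.
≟-suc : ∀ m n → ⌊ suc m ℕ.≟ suc n ⌋ ≡ ⌊ m ℕ.≟ n ⌋
≟-suc m n = trans (isYes≗does (suc m ℕ.≟ suc n)) (sym (isYes≗does (m ℕ.≟ n)))

<?-suc : ∀ m n → ⌊ suc m ℕ.<? suc n ⌋ ≡ ⌊ m ℕ.<? n ⌋
<?-suc m n = trans (isYes≗does (suc m ℕ.<? suc n)) (sym (isYes≗does (m ℕ.<? n)))

≟-suc⇒≢0 : ∀ m n → ⌊ m ℕ.≟ suc n ⌋ ≡ true → ⌊ m ℕ.≟ 0 ⌋ ≡ false
≟-suc⇒≢0 (suc m) n _ = refl

-- pinch zero merges levels 0 and 1 and lowers every higher level by one.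
toℕ-pinch₀-≟ : ∀ {ℓ} (v : Fin (suc (suc ℓ))) {n} → 1 ≤ n →
               ⌊ toℕ (pinch Fin.zero v) ℕ.≟ n ⌋ ≡ ⌊ toℕ v ℕ.≟ suc n ⌋
toℕ-pinch₀-≟ Fin.zero     (ℕ.s≤s ℕ.z≤n) = refl
toℕ-pinch₀-≟ (Fin.suc w) {n} _         = sym (≟-suc (toℕ w) n)

toℕ-pinch₀-<? : ∀ {ℓ} (v : Fin (suc (suc ℓ))) {n} → 1 ≤ n →
                ⌊ toℕ (pinch Fin.zero v) ℕ.<? n ⌋ ≡ ⌊ toℕ v ℕ.<? suc n ⌋
toℕ-pinch₀-<? Fin.zero     (ℕ.s≤s ℕ.z≤n) = refl
toℕ-pinch₀-<? (Fin.suc w) {n} _         = sym (<?-suc (toℕ w) n)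

mergeLevels-pointwise : ∀ {ℓ} (v : Fin (suc (suc ℓ))) (t c μ a : ℤ) →
  (if ⌊ toℕ (pinch Fin.zero v) ℕ.≟ 0 ⌋ then (if ⌊ toℕ v ℕ.≟ 0 ⌋ then t ℤ.- μ else c) * a else 0ℤ)
    + (if ⌊ toℕ v ℕ.<? 1 ⌋ then μ * a else 0ℤ)
  ≡ t * (if ⌊ toℕ v ℕ.≟ 0 ⌋ then a else 0ℤ) + c * (if ⌊ toℕ v ℕ.≟ 1 ⌋ then a else 0ℤ)
mergeLevels-pointwise Fin.zero                  = level₀-case
  where
  level₀-case : ∀ t c μ a → (t ℤ.- μ) * a + μ * a ≡ t * a + c * 0ℤ
  level₀-case = solve-∀
mergeLevels-pointwise (Fin.suc Fin.zero)        = level₁-case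
  where
  level₁-case : ∀ t c μ a → c * a + 0ℤ ≡ t * 0ℤ + c * a
  level₁-case = solve-∀
mergeLevels-pointwise (Fin.suc (Fin.suc w))     = higher-case
  where
  higher-case : ∀ t c μ a → 0ℤ + 0ℤ ≡ t * 0ℤ + c * 0ℤ
  higher-case = solve-∀

-- Σ_{J₀} μ_j a_j is added to both sides and then cancelled, so no subtraction occurs under a sum.
mergedLevel-sum≡0 : ∀ {m k ℓ} (A : Matrix m k) (lvl : Fin k → Fin (suc (suc ℓ)))
                    (t c : ℤ) (μ : Fin k → ℤ) →
  (∀ i → sumOver (atLevel lvl 0) (A i) ≡ 0ℤ) →
  (∀ i → sumOver (belowLevel lvl 1) (λ j → μ j * A i j) ≡ c * sumOver (atLevel lvl 1) (A i)) →
  ∀ i → sumOver (atLevel (pinch Fin.zero ∘ lvl) 0)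
                (scaleColumns (λ j → if atLevel lvl 0 j then t ℤ.- μ j else c) A i) ≡ 0ℤ
mergedLevel-sum≡0 {k = k} A lvl t c μ level₀ level₁ i = ∙-cancelʳ Y X 0ℤ (begin
  X + Y
    ≡⟨ sumℤ-distrib-+ merged below ⟨
  sumℤ (λ j → merged j + below j)
    ≡⟨ sumℤ-cong (λ j → mergeLevels-pointwise (lvl j) t c (μ j) (A i j)) ⟩
  sumℤ (λ j → t * at₀ j + c * at₁ j)
    ≡⟨ sumℤ-distrib-+ (λ j → t * at₀ j) (λ j → c * at₁ j) ⟩
  sumℤ (λ j → t * at₀ j) + sumℤ (λ j → c * at₁ j)
    ≡⟨ cong₂ _+_ (*-distribˡ-sumℤ t at₀) (*-distribˡ-sumℤ c at₁) ⟨
  t * sumOver (atLevel lvl 0) (A i) + c * sumOver (atLevel lvl 1) (A i)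
    ≡⟨ cong₂ _+_ (cong (t *_) (level₀ i)) (sym (level₁ i)) ⟩
  t * 0ℤ + Y
    ≡⟨ cong (_+ Y) (ℤ.*-zeroʳ t) ⟩
  0ℤ + Y ∎)
  where
  open ≡-Reasoning
  τ : Fin k → ℤ
  τ j = if atLevel lvl 0 j then t ℤ.- μ j else c
  merged below at₀ at₁ : Fin k → ℤ
  merged j = if atLevel (pinch Fin.zero ∘ lvl) 0 j then τ j * A i j else 0ℤ
  below  j = if belowLevel lvl 1 j then μ j * A i j else 0ℤ
  at₀    j = if atLevel lvl 0 j then A i j else 0ℤ
  at₁    j = if atLevel lvl 1 j then A i j else 0ℤ
  X Y : ℤ
  X = sumℤ merged
  Y = sumℤ below

if-affine : ∀ b (a s c y : ℤ) →
            (if b then a + s * y else c * y) ≡ (if b then a else 0ℤ) + (if b then s else c) * y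
if-affine true  a s c y = refl
if-affine false a s c y = sym (ℤ.+-identityˡ (c * y))

lemma5p7 : (m k ℓ : ℕ) (A : Matrix m k) → ColumnsCondition (suc ℓ) A →
    Σ ℕ λ c → 1 ≤ c × Σ (Fin k → Bool) λ J → Σ (Fin k → ℤ) λ σ → Σ (Matrix m k) λ B →
      ColumnsCondition ℓ B ×
      ((y : Fin k → ℤ) → ((i : Fin m) → (B · y) i ≡ 0ℤ) →
        (a : ℤ) → (i : Fin m) →
          (A · (λ j → if J j then a + σ j * y j else (+ c) * y j)) i ≡ 0ℤ)
lemma5p7 m k ℓ A (lvl , level₀ , upper)
  with clearDenominators (upper (Fin.suc Fin.zero) (ℕ.s≤s ℕ.z≤n))
... | d , μ , level₁ with upperBound μ
... | t , μ<t = c , ℕ.s≤s ℕ.z≤n , J , σ , scaleColumns τ A ,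
                (pinch Fin.zero ∘ lvl , mergedLevel-sum≡0 A lvl t (+ c) μ level₀ level₁ , upperᴮ) ,
                kernel
  where
  c : ℕ
  c = suc d
  J : Fin k → Bool
  J = atLevel lvl 0
  σ : Fin k → ℤ
  σ j = t ℤ.- μ j
  τ : Fin k → ℤ
  τ j = if J j then σ j else + c
  τ≢0 : ∀ j → τ j ≢ 0ℤ
  τ≢0 j with J j
  ... | true  = λ σ≡0 → ℤ.<⇒≢ (μ<t j) (sym (ℤ.i-j≡0⇒i≡j t (μ j) σ≡0))
  ... | false = λ ()
  upperᴮ : ∀ s → 1 ≤ toℕ s → SpanRelation (scaleColumns τ A)
             (atLevel (pinch Fin.zero ∘ lvl) (toℕ s)) (belowLevel (pinch Fin.zero ∘ lvl) (toℕ s))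
  upperᴮ s 1≤s = SpanRelation-congˢ
    (λ j → sym (toℕ-pinch₀-≟ (lvl j) 1≤s)) (λ j → sym (toℕ-pinch₀-<? (lvl j) 1≤s))
    (SpanRelation-scaleColumns τ (+ c) τ≢0
      (λ j at → cong (if_then σ j else + c) (≟-suc⇒≢0 (toℕ (lvl j)) (toℕ s) at))
      (upper (Fin.suc s) (ℕ.s≤s ℕ.z≤n)))
  kernel : (y : Fin k → ℤ) → (∀ i → (scaleColumns τ A · y) i ≡ 0ℤ) →
           ∀ a i → (A · (λ j → if J j then a + σ j * y j else + c * y j)) i ≡ 0ℤ
  kernel y By≡0 a i = trans (sumℤ-cong (λ j → cong (A i j *_) (if-affine (J j) a (σ j) (+ c) (y j))))
                            (kernel-lift A J τ y level₀ By≡0 a i)
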